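{- For any graph $G$ without isolated vertices, $sp(G)\le 1+\left\lfloor \frac{\Delta(G)}{\delta(G)}\right\rfloor$. Moreover, if $G$ is non-regular (i.e. $\Delta(G)\ne\delta(G)$), then $sp(G)\le \left\lceil \frac{\Delta(G)}{\delta(G)}\right\rceil$.
   Context: Graphs are finite, undirected, without loops, possibly with multiple edges. $\Delta(G)$ and $\delta(G)$ are the maximum and minimum degrees. For a graph $G$ without isolated vertices, $sp(G)$ is the least integer $k$ such that $G$ has a subgraph $H$ with $V(H)=V(G)$ and $1\le d_H(x)\le k$ for all vertices $x$. -}

module Defs where

open import Data.Nat using (ℕ; zero; suc; _+_; _∸_; _≤_; _⊔_; _⊓_; NonZero)
open import Data.Nat.DivMod using (_/_)
open import Data.Fin using (Fin; _≟_)
import Data.Fin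
open import Data.Product using (_×_; _,_; proj₁; proj₂)
open import Data.List using (List; []; _∷_; foldr; map; allFin)
open import Data.List.Relation.Unary.All using (All)
open import Data.List.Relation.Binary.Sublist.Propositional using (_⊆_)
open import Relation.Binary.PropositionalEquality using (_≢_)
open import Relation.Nullary using (does)
open import Data.Bool using (if_then_else_)

-- A (loopless multi)graph on the vertex set Fin n: a list of edges
-- (multiple edges = repeated entries), no edge is a loop.
record Graph : Set where
  field
    n       : ℕ
    edges   : List (Fin n × Fin n)
    noLoops : All (λ e → proj₁ e ≢ proj₂ e) edges
open Graph public

degIn : ∀ {n} → List (Fin n × Fin n) → Fin n → ℕ
degIn [] x = 0
degIn ((u , v) ∷ es) x =
  (if does (u ≟ x) then 1 else (if does (v ≟ x) then 1 else 0)) + degIn es x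

deg : (G : Graph) → Fin (n G) → ℕ
deg G = degIn (edges G)

Δ : Graph → ℕ
Δ G = foldr _⊔_ 0 (map (deg G) (allFin (n G)))

-- minimum of f over Fin n (0 when n = 0)
minOver : ∀ n → (Fin n → ℕ) → ℕ
minOver zero    f = 0
minOver (suc m) f = foldr _⊓_ (f Data.Fin.zero) (map f (allFin (suc m)))

δ : Graph → ℕ
δ G = minOver (n G) (deg G)

NoIsolatedVertices : Graph → Set
NoIsolatedVertices G = ∀ (x : Fin (n G)) → 1 ≤ deg G x

-- G has a spanning subgraph H (same vertices, a sub-multiset of the edges)
-- with 1 ≤ d_H(x) ≤ k for every vertex x.
HasSpanningSub : Graph → ℕ → Set
HasSpanningSub G k =
  Data.Product.Σ (List (Fin (n G) × Fin (n G))) λ H →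
    (H ⊆ edges G) × (∀ (x : Fin (n G)) → (1 ≤ degIn H x) × (degIn H x ≤ k))
  where import Data.Product

IsSp : Graph → ℕ → Set
IsSp G s = HasSpanningSub G s × (∀ k → HasSpanningSub G k → s ≤ k)

ceilDiv : (m d : ℕ) → .{{NonZero d}} → ℕ
ceilDiv m d = (m + d ∸ 1) / d

module Submission where

-- Both bounds follow from one statement, `Balancing.bounded-spanning-subgraph`:
-- if k ≥ 2, a ≥ 1 and a ≤ deg(v) ≤ b ≤ k·a for every vertex v, then G has a
-- spanning subgraph H with 1 ≤ d_H ≤ k.  (Take a = δ, b = Δ and k = 1 + ⌊Δ/δ⌋,
-- or k = ⌈Δ/δ⌉, which is ≥ 2 once Δ > δ.)  Starting from H = G, we lower the
-- excess Σ_v max(0, d_H(v) − k) while never isolating a vertex.  An overloaded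
-- vertex r is relieved (`Relief`) by deleting an edge to a vertex of degree ≥ 2,
-- or by rerouting a leaf of r to a neighbour with spare capacity, recursively
-- along paths r – leaf – vertex – leaf – ….  If this search fails it yields a
-- closed set C ∋ r of saturated vertices, and double counting the edges between
-- C and its leaves X gives a(k|C| + 1) ≤ a|X| ≤ k·a|C|, a contradiction
-- (`Saturation.Obstruction`).

open import Defs
open import Data.Nat hiding (_≟_; _/_)
open import Data.Nat.Properties hiding (_≟_)
open import Data.Nat.DivMod using (_/_; _%_; m≡m%n+[m/n]*n; m%n<n; m*n/n≡m; /-monoˡ-≤; m≥n⇒m/n>0)
open import Data.Nat.Tactic.RingSolver using (solve-∀)
open import Data.Fin using (Fin; zero; suc; _≟_; punchIn; fromℕ<)
open import Data.Fin.Properties using (punchInᵢ≢i; any?)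
open import Data.Bool using (Bool; true; false; if_then_else_; _∨_; not)
import Data.Bool as Bool
open import Data.Bool.Properties using (∨-identityʳ; ∨-assoc; ∨-comm)
open import Data.Product using (_×_; _,_; proj₁; proj₂; Σ; ∃)
open import Data.Sum using (_⊎_; inj₁; inj₂; [_,_]′)
import Data.Sum
open import Data.List using (List; []; _∷_; length; lookup)
open import Data.List.Properties using (foldr-preservesᵒ)
import Data.List.Relation.Unary.All as All
open import Data.List.Relation.Unary.Any.Properties using (map⁺)
open import Data.List.Membership.Propositional using (lose)
open import Data.List.Membership.Propositional.Properties using (∈-lookup; ∈-allFin)
open import Data.List.Relation.Binary.Sublist.Propositional using (_⊆_; []; _∷_; _∷ʳ_)
open import Data.Empty using (⊥; ⊥-elim)
open import Relation.Nullary using (does; yes; no; ¬_; Dec; _×-dec_; _⊎-dec_)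
open import Relation.Binary.PropositionalEquality
open import Algebra.Properties.Semiring.Sum +-*-semiring
  using (sum; sum-syntax; sum-cong-≗; sum-remove; sum-replicate-zero; ∑-distrib-+; ∑-comm; *-distribˡ-sum)

sum-mono : ∀ {K} {f g : Fin K → ℕ} → (∀ i → f i ≤ g i) → sum f ≤ sum g
sum-mono {zero}  f≤g = z≤n
sum-mono {suc K} f≤g = +-mono-≤ (f≤g zero) (sum-mono (λ i → f≤g (suc i)))

sum-mono-< : ∀ {K} {f g : Fin K → ℕ} → (∀ i → f i ≤ g i) → (a : Fin K) → f a < g a → sum f < sum g
sum-mono-< {suc K} f≤g zero    fa<ga = +-mono-<-≤ fa<ga (sum-mono (λ i → f≤g (suc i)))
sum-mono-< {suc K} f≤g (suc a) fa<ga = +-mono-≤-< (f≤g zero) (sum-mono-< (λ i → f≤g (suc i)) a fa<ga)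

term≤sum : ∀ {K} (f : Fin K → ℕ) (t : Fin K) → f t ≤ sum f
term≤sum f zero    = m≤m+n (f zero) _
term≤sum f (suc t) = ≤-trans (term≤sum (λ i → f (suc i)) t) (m≤n+m _ (f zero))

sum-update : ∀ {K} {f g : Fin K → ℕ} (i : Fin K) → (∀ t → t ≢ i → f t ≡ g t) →
  sum f + g i ≡ sum g + f i
sum-update {suc K} {f} {g} i agree = begin
  sum f + g i               ≡⟨ cong (_+ g i) (sum-remove {i = i} f) ⟩
  f i + sum (skip f) + g i  ≡⟨ cong (λ s → f i + s + g i) (sum-cong-≗ off-i) ⟩
  f i + sum (skip g) + g i  ≡⟨ swap (f i) (sum (skip g)) (g i) ⟩
  g i + sum (skip g) + f i  ≡⟨ cong (_+ f i) (sum-remove {i = i} g) ⟨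
  sum g + f i               ∎
  where
  open ≡-Reasoning
  skip : (Fin (suc K) → ℕ) → Fin K → ℕ
  skip h t = h (punchIn i t)
  off-i : ∀ t → skip f t ≡ skip g t
  off-i t = agree (punchIn i t) (punchInᵢ≢i i t)
  swap : ∀ a s b → a + s + b ≡ b + s + a
  swap = solve-∀

indicator : ∀ {K} → Fin K → Fin K → ℕ
indicator a v = if does (a ≟ v) then 1 else 0

sum-indicator : ∀ {K} (w : Fin K → ℕ) (a : Fin K) → sum (λ v → indicator a v * w v) ≡ w a
sum-indicator {K} w a = begin
  sum (λ v → indicator a v * w v)          ≡⟨ +-identityʳ _ ⟨
  sum (λ v → indicator a v * w v) + 0      ≡⟨ sum-update a off-a ⟩
  sum {K} (λ _ → 0) + indicator a a * w a  ≡⟨ cong₂ _+_ (sum-replicate-zero K) (cong (_* w a) at-a) ⟩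
  0 + 1 * w a                              ≡⟨ *-identityˡ (w a) ⟩
  w a                                      ∎
  where
  open ≡-Reasoning
  off-a : ∀ t → t ≢ a → indicator a t * w t ≡ 0
  off-a t t≢a with a ≟ t
  ... | yes a≡t = ⊥-elim (t≢a (sym a≡t))
  ... | no _    = refl
  at-a : indicator a a ≡ 1
  at-a with a ≟ a
  ... | yes _   = refl
  ... | no a≢a  = ⊥-elim (a≢a refl)

-- keep b a is a if b holds and 0 otherwise: a Boolean mask selects edges by
-- keeping their contributions.  It commutes with scaling and with sums.
keep : Bool → ℕ → ℕ
keep b a = if b then a else 0

keep-mono : ∀ b {x y} → (b ≡ true → x ≤ y) → keep b x ≤ keep b y
keep-mono true  x≤y = x≤y refl
keep-mono false _   = z≤n

*-keep : ∀ w b a → w * keep b a ≡ keep b (w * a)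
*-keep w true  a = refl
*-keep w false a = *-zeroʳ w

sum-keep : ∀ {K} b (f : Fin K → ℕ) → sum (λ v → keep b (f v)) ≡ keep b (sum f)
sum-keep true  f = refl
sum-keep {K} false f = sum-replicate-zero K

incidence : ∀ {N} → Fin N × Fin N → Fin N → ℕ
incidence (u , v) x = if does (u ≟ x) then 1 else (if does (v ≟ x) then 1 else 0)

select : ∀ {A : Set} (es : List A) → (Fin (length es) → Bool) → List A
select []       m = []
select (e ∷ es) m = if m zero then e ∷ select es (λ t → m (suc t)) else select es (λ t → m (suc t))

select-⊆ : ∀ {A : Set} (es : List A) m → select es m ⊆ es
select-⊆ []       m = []
select-⊆ (e ∷ es) m with m zero
... | true  = refl ∷ select-⊆ es (λ t → m (suc t))
... | false = e ∷ʳ select-⊆ es (λ t → m (suc t))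

degIn-select : ∀ {N} (es : List (Fin N × Fin N)) m x →
  degIn (select es m) x ≡ sum (λ t → keep (m t) (incidence (lookup es t) x))
degIn-select []       m x = refl
degIn-select (e ∷ es) m x with m zero
... | true  = cong (incidence e x +_) (degIn-select es (λ t → m (suc t)) x)
... | false = degIn-select es (λ t → m (suc t)) x

degIn-sum : ∀ {N} (es : List (Fin N × Fin N)) x → degIn es x ≡ sum (λ t → incidence (lookup es t) x)
degIn-sum []       x = refl
degIn-sum (e ∷ es) x = cong (incidence e x +_) (degIn-sum es x)

update : ∀ {L} → (Fin L → Bool) → Fin L → Bool → Fin L → Bool
update m i b t = if does (t ≟ i) then b else m t

update-same : ∀ {L} (m : Fin L → Bool) i b → update m i b i ≡ b
update-same m i b with i ≟ i
... | yes _  = refl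
... | no i≢i = ⊥-elim (i≢i refl)

update-other : ∀ {L} (m : Fin L → Bool) i b t → t ≢ i → update m i b t ≡ m t
update-other m i b t t≢i with t ≟ i
... | yes t≡i = ⊥-elim (t≢i t≡i)
... | no _    = refl

update-changed : ∀ {L} (m : Fin L → Bool) i b t → update m i b t ≢ m t → t ≡ i
update-changed m i b t changed with t ≟ i
... | yes t≡i = t≡i
... | no _    = ⊥-elim (changed refl)

-- Spanning subgraphs H of G, encoded as masks on the positions of its edge list;
-- degree m v is d_H(v), and the mask `full` is G itself.
module Subgraphs (G : Graph) where

  N : ℕ
  N = n G

  L : ℕ
  L = length (edges G)

  Mask : Set
  Mask = Fin L → Bool

  src tgt : Fin L → Fin N
  src t = proj₁ (lookup (edges G) t)
  tgt t = proj₂ (lookup (edges G) t)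

  loopless : ∀ t → src t ≢ tgt t
  loopless t = All.lookup (noLoops G) (∈-lookup t)

  inc : Fin L → Fin N → ℕ
  inc t = incidence (lookup (edges G) t)

  degree : Mask → Fin N → ℕ
  degree m v = sum (λ t → keep (m t) (inc t v))

  full : Mask
  full _ = true

  deg-full : ∀ v → deg G v ≡ degree full v
  deg-full = degIn-sum (edges G)

  End : Fin L → Fin N → Set
  End t v = src t ≡ v ⊎ tgt t ≡ v

  End? : ∀ t v → Dec (End t v)
  End? t v = (src t ≟ v) ⊎-dec (tgt t ≟ v)

  Adj : Fin L → Fin N → Fin N → Set
  Adj t a b = (src t ≡ a × tgt t ≡ b) ⊎ (src t ≡ b × tgt t ≡ a)

  Adj? : ∀ t a b → Dec (Adj t a b)
  Adj? t a b = ((src t ≟ a) ×-dec (tgt t ≟ b)) ⊎-dec ((src t ≟ b) ×-dec (tgt t ≟ a))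

  Adj-sym : ∀ {t a b} → Adj t a b → Adj t b a
  Adj-sym (inj₁ e) = inj₂ e
  Adj-sym (inj₂ e) = inj₁ e

  Adj-endˡ : ∀ {t a b} → Adj t a b → End t a
  Adj-endˡ (inj₁ (p , _)) = inj₁ p
  Adj-endˡ (inj₂ (_ , q)) = inj₂ q

  Adj-endʳ : ∀ {t a b} → Adj t a b → End t b
  Adj-endʳ a = Adj-endˡ (Adj-sym a)

  Adj-≢ : ∀ {t a b} → Adj t a b → a ≢ b
  Adj-≢ {t} (inj₁ (refl , refl)) a≡b = loopless t a≡b
  Adj-≢ {t} (inj₂ (refl , refl)) a≡b = loopless t (sym a≡b)

  End-Adj : ∀ {t a b v} → Adj t a b → End t v → v ≡ a ⊎ v ≡ b
  End-Adj (inj₁ (refl , refl)) (inj₁ refl) = inj₁ refl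
  End-Adj (inj₁ (refl , refl)) (inj₂ refl) = inj₂ refl
  End-Adj (inj₂ (refl , refl)) (inj₁ refl) = inj₂ refl
  End-Adj (inj₂ (refl , refl)) (inj₂ refl) = inj₁ refl

  inc-end : ∀ {t v} → End t v → inc t v ≡ 1
  inc-end {t} {v} e with src t ≟ v | tgt t ≟ v
  ... | yes _ | _     = refl
  ... | no _  | yes _ = refl
  inc-end (inj₁ s≡v) | no s≢v | no _   = ⊥-elim (s≢v s≡v)
  inc-end (inj₂ t≡v) | no _   | no t≢v = ⊥-elim (t≢v t≡v)

  inc-non-end : ∀ {t v} → ¬ End t v → inc t v ≡ 0
  inc-non-end {t} {v} ¬e with src t ≟ v | tgt t ≟ v
  ... | yes s≡v | _       = ⊥-elim (¬e (inj₁ s≡v))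
  ... | no _    | yes t≡v = ⊥-elim (¬e (inj₂ t≡v))
  ... | no _    | no _    = refl

  inc≤1 : ∀ t v → inc t v ≤ 1
  inc≤1 t v with End? t v
  ... | yes e  = ≤-reflexive (inc-end e)
  ... | no ¬e  = subst (_≤ 1) (sym (inc-non-end ¬e)) z≤n

  degree-pos : ∀ (m : Mask) {t v} → m t ≡ true → End t v → 1 ≤ degree m v
  degree-pos m {t} {v} mt e = begin
    1                     ≡⟨ inc-end e ⟨
    inc t v               ≡⟨ cong (λ b → keep b (inc t v)) mt ⟨
    keep (m t) (inc t v)  ≤⟨ term≤sum (λ s → keep (m s) (inc s v)) t ⟩
    degree m v            ∎
    where open ≤-Reasoning

  degree-ext : ∀ (m m′ : Mask) v → (∀ t → End t v → m′ t ≡ m t) → degree m′ v ≡ degree m v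
  degree-ext m m′ v agree = sum-cong-≗ same
    where
    same : ∀ t → keep (m′ t) (inc t v) ≡ keep (m t) (inc t v)
    same t with End? t v
    ... | yes e  = cong (λ b → keep b (inc t v)) (agree t e)
    ... | no ¬e rewrite inc-non-end ¬e with m′ t | m t
    ...   | true  | true  = refl
    ...   | true  | false = refl
    ...   | false | true  = refl
    ...   | false | false = refl

  degree-update : ∀ (m : Mask) i b v →
    degree (update m i b) v + keep (m i) (inc i v) ≡ degree m v + keep b (inc i v)
  degree-update m i b v =
    subst (λ b′ → degree (update m i b) v + keep (m i) (inc i v) ≡ degree m v + keep b′ (inc i v))
      (update-same m i b)
      (sum-update i (λ t t≢i → cong (λ b′ → keep b′ (inc t v)) (update-other m i b t t≢i)))

  delete add : Mask → Fin L → Mask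
  delete m i = update m i false
  add    m j = update m j true

  delete-degree : ∀ {m : Mask} {i} → m i ≡ true → ∀ v → degree (delete m i) v + inc i v ≡ degree m v
  delete-degree {m} {i} mi v = begin
    degree (delete m i) v + inc i v               ≡⟨ cong (λ b → degree (delete m i) v + keep b (inc i v)) mi ⟨
    degree (delete m i) v + keep (m i) (inc i v)  ≡⟨ degree-update m i false v ⟩
    degree m v + 0                                ≡⟨ +-identityʳ _ ⟩
    degree m v                                    ∎
    where open ≡-Reasoning

  delete-≤ : ∀ {m : Mask} {i} → m i ≡ true → ∀ v → degree (delete m i) v ≤ degree m v
  delete-≤ mi v = ≤-trans (m≤m+n _ _) (≤-reflexive (delete-degree mi v))

  delete-end : ∀ {m : Mask} {i v} → m i ≡ true → End i v → degree (delete m i) v + 1 ≡ degree m v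
  delete-end {m} {i} {v} mi e = trans (cong (degree (delete m i) v +_) (sym (inc-end e))) (delete-degree mi v)

  delete-non-end : ∀ {m : Mask} {i v} → m i ≡ true → ¬ End i v → degree (delete m i) v ≡ degree m v
  delete-non-end {m} {i} {v} mi ¬e =
    trans (sym (+-identityʳ _)) (trans (cong (degree (delete m i) v +_) (sym (inc-non-end ¬e))) (delete-degree mi v))

  add-≤ : ∀ (m : Mask) j v → degree (add m j) v ≤ degree m v + inc j v
  add-≤ m j v = ≤-trans (m≤m+n _ _) (≤-reflexive (degree-update m j true v))

  add-non-end : ∀ (m : Mask) {j v} → ¬ End j v → degree (add m j) v ≡ degree m v
  add-non-end m {j} {v} ¬e = degree-ext m (add m j) v (λ t e → update-other m j true t (λ { refl → ¬e e }))

  add-end : ∀ (m : Mask) {j v} → End j v → 1 ≤ degree (add m j) v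
  add-end m {j} e = degree-pos (add m j) (update-same m j true) e

  -- Since G has no loops, an edge is incident exactly to its two distinct endpoints.
  inc-split : ∀ t v → inc t v ≡ indicator (src t) v + indicator (tgt t) v
  inc-split t v with src t ≟ v | tgt t ≟ v
  ... | yes s≡v | yes t≡v = ⊥-elim (loopless t (trans s≡v (sym t≡v)))
  ... | yes _   | no _    = refl
  ... | no _    | yes _   = refl
  ... | no _    | no _    = refl

  sum-weight-inc : ∀ (w : Fin N → ℕ) t → ∑[ v < N ] (w v * inc t v) ≡ w (src t) + w (tgt t)
  sum-weight-inc w t = begin
    ∑[ v < N ] (w v * inc t v)
      ≡⟨ sum-cong-≗ split ⟩
    ∑[ v < N ] (indicator (src t) v * w v + indicator (tgt t) v * w v)
      ≡⟨ ∑-distrib-+ (λ v → indicator (src t) v * w v) (λ v → indicator (tgt t) v * w v) ⟩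
    ∑[ v < N ] (indicator (src t) v * w v) + ∑[ v < N ] (indicator (tgt t) v * w v)
      ≡⟨ cong₂ _+_ (sum-indicator w (src t)) (sum-indicator w (tgt t)) ⟩
    w (src t) + w (tgt t) ∎
    where
    open ≡-Reasoning
    split : ∀ v → w v * inc t v ≡ indicator (src t) v * w v + indicator (tgt t) v * w v
    split v = begin
      w v * inc t v                                                ≡⟨ cong (w v *_) (inc-split t v) ⟩
      w v * (indicator (src t) v + indicator (tgt t) v)           ≡⟨ *-distribˡ-+ (w v) (indicator (src t) v) _ ⟩
      w v * indicator (src t) v + w v * indicator (tgt t) v       ≡⟨ cong₂ _+_ (*-comm (w v) _) (*-comm (w v) _) ⟩
      indicator (src t) v * w v + indicator (tgt t) v * w v       ∎

  handshake : ∀ (w : Fin N → ℕ) (m : Mask) →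
    ∑[ v < N ] (w v * degree m v) ≡ ∑[ t < L ] keep (m t) (w (src t) + w (tgt t))
  handshake w m = begin
    ∑[ v < N ] (w v * degree m v)
      ≡⟨ sum-cong-≗ (λ v → *-distribˡ-sum (w v) (λ t → keep (m t) (inc t v))) ⟩
    ∑[ v < N ] ∑[ t < L ] (w v * keep (m t) (inc t v))
      ≡⟨ ∑-comm (λ v t → w v * keep (m t) (inc t v)) ⟩
    ∑[ t < L ] ∑[ v < N ] (w v * keep (m t) (inc t v))
      ≡⟨ sum-cong-≗ per-edge ⟩
    ∑[ t < L ] keep (m t) (w (src t) + w (tgt t)) ∎
    where
    open ≡-Reasoning
    per-edge : ∀ t → ∑[ v < N ] (w v * keep (m t) (inc t v)) ≡ keep (m t) (w (src t) + w (tgt t))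
    per-edge t = begin
      ∑[ v < N ] (w v * keep (m t) (inc t v))  ≡⟨ sum-cong-≗ (λ v → *-keep (w v) (m t) (inc t v)) ⟩
      ∑[ v < N ] keep (m t) (w v * inc t v)    ≡⟨ sum-keep (m t) (λ v → w v * inc t v) ⟩
      keep (m t) (∑[ v < N ] (w v * inc t v))  ≡⟨ cong (keep (m t)) (sum-weight-inc w t) ⟩
      keep (m t) (w (src t) + w (tgt t))       ∎

  weighted-degree-transfer : ∀ (p q : Fin N → ℕ) (m : Mask) →
    (∀ t a b → m t ≡ true → Adj t a b → p a ≤ q b) →
    ∑[ v < N ] (p v * degree m v) ≤ ∑[ v < N ] (q v * degree m v)
  weighted-degree-transfer p q m p≤q = begin
    ∑[ v < N ] (p v * degree m v)                 ≡⟨ handshake p m ⟩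
    ∑[ t < L ] keep (m t) (p (src t) + p (tgt t)) ≤⟨ sum-mono per-edge ⟩
    ∑[ t < L ] keep (m t) (q (src t) + q (tgt t)) ≡⟨ handshake q m ⟨
    ∑[ v < N ] (q v * degree m v)                 ∎
    where
    open ≤-Reasoning
    per-edge : ∀ t → keep (m t) (p (src t) + p (tgt t)) ≤ keep (m t) (q (src t) + q (tgt t))
    per-edge t = keep-mono (m t) λ mt → begin
      p (src t) + p (tgt t) ≤⟨ +-mono-≤ (p≤q t _ _ mt (inj₁ (refl , refl))) (p≤q t _ _ mt (inj₂ (refl , refl))) ⟩
      q (tgt t) + q (src t) ≡⟨ +-comm (q (tgt t)) _ ⟩
      q (src t) + q (tgt t) ∎

  NoIsolated : Mask → Set
  NoIsolated m = ∀ v → 1 ≤ degree m v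

  module Deletion {m : Mask} {i c y} (mi : m i ≡ true) (ai : Adj i c y) where

    lose-one : ∀ {v} → End i v → 2 ≤ degree m v → 1 ≤ degree (delete m i) v
    lose-one {v} e 2≤dv = +-cancelʳ-≤ 1 1 _ (≤-trans 2≤dv (≤-reflexive (sym (delete-end mi e))))

    no-isolated : NoIsolated m → 2 ≤ degree m c → 2 ≤ degree m y → NoIsolated (delete m i)
    no-isolated valid 2≤dc 2≤dy v with End? i v
    ... | no ¬e = subst (1 ≤_) (sym (delete-non-end mi ¬e)) (valid v)
    ... | yes e with End-Adj ai e
    ...   | inj₁ refl = lose-one e 2≤dc
    ...   | inj₂ refl = lose-one e 2≤dy

  module Shift (m₀ : Mask) {i j c x w} (m₀i : m₀ i ≡ true) (ai : Adj i c x) (aj : Adj j x w) (w≢c : w ≢ c) where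

    shifted : Mask
    shifted = add (delete m₀ i) j

    c-off-j : ¬ End j c
    c-off-j e with End-Adj aj e
    ... | inj₁ c≡x = Adj-≢ ai c≡x
    ... | inj₂ c≡w = w≢c (sym c≡w)

    off-j : ∀ {v} → ¬ End j v → degree shifted v ≤ degree m₀ v
    off-j {v} ¬e = ≤-trans (≤-reflexive (add-non-end (delete m₀ i) ¬e)) (delete-≤ m₀i v)

    off-both : ∀ {v} → ¬ End i v → ¬ End j v → degree shifted v ≡ degree m₀ v
    off-both {v} ¬eᵢ ¬eⱼ = trans (add-non-end (delete m₀ i) ¬eⱼ) (delete-non-end m₀i ¬eᵢ)

    at-c : degree shifted c + 1 ≡ degree m₀ c
    at-c = trans (cong (_+ 1) (add-non-end (delete m₀ i) c-off-j)) (delete-end m₀i (Adj-endˡ ai))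

    at-x : degree shifted x ≤ degree m₀ x
    at-x = begin
      degree shifted x                       ≤⟨ add-≤ (delete m₀ i) j x ⟩
      degree (delete m₀ i) x + inc j x       ≡⟨ cong (degree (delete m₀ i) x +_) both-at-x ⟩
      degree (delete m₀ i) x + inc i x       ≡⟨ delete-degree m₀i x ⟩
      degree m₀ x                            ∎
      where
      open ≤-Reasoning
      both-at-x : inc j x ≡ inc i x
      both-at-x = trans (inc-end (Adj-endˡ aj)) (sym (inc-end (Adj-endʳ ai)))

    at-w : degree shifted w ≤ suc (degree m₀ w)
    at-w = begin
      degree shifted w                       ≤⟨ add-≤ (delete m₀ i) j w ⟩
      degree (delete m₀ i) w + inc j w       ≤⟨ +-mono-≤ (delete-≤ m₀i w) (inc≤1 j w) ⟩
      degree m₀ w + 1                        ≡⟨ +-comm _ 1 ⟩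
      suc (degree m₀ w)                      ∎
      where open ≤-Reasoning

    on-j : ∀ {v} → End j v → 1 ≤ degree shifted v
    on-j = add-end (delete m₀ i)

    no-isolated : NoIsolated m₀ → 2 ≤ degree m₀ c → NoIsolated shifted
    no-isolated valid 2≤dc v with End? j v
    ... | yes e  = on-j e
    ... | no ¬eⱼ with End? i v
    ...   | no ¬eᵢ = subst (1 ≤_) (sym (off-both ¬eᵢ ¬eⱼ)) (valid v)
    ...   | yes eᵢ with End-Adj ai eᵢ
    ...     | inj₂ refl = ⊥-elim (¬eⱼ (Adj-endˡ aj))
    ...     | inj₁ refl = +-cancelʳ-≤ 1 1 _ (≤-trans 2≤dc (≤-reflexive (sym at-c)))

module Saturation (G : Graph) (k : ℕ) (m : Subgraphs.Mask G) where
  open Subgraphs G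

  d : Fin N → ℕ
  d = degree m

  Saturated : Fin N → Set
  Saturated v = k ≤ d v × (∀ i y → m i ≡ true → Adj i v y → d y ≤ 1)

  VSet : Set
  VSet = Fin N → Bool

  _∪_ : VSet → VSet → VSet
  (A ∪ B) v = A v ∨ B v

  ∅ : VSet
  ∅ _ = false

  -- F is closed relative to S when every G-neighbour of every leaf hanging from F
  -- lies in F ∪ S: no rerouting path leaves F ∪ S.
  Closed : VSet → VSet → Set
  Closed F S = ∀ c i x j w → F c ≡ true → m i ≡ true → Adj i c x → Adj j x w → (F ∪ S) w ≡ true

  count : Bool → ℕ
  count b = keep b 1

  count≤1 : ∀ b → count b ≤ 1
  count≤1 true  = ≤-refl
  count≤1 false = z≤n

  size : VSet → ℕ
  size A = ∑[ v < N ] count (A v)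

  -- With X the set of leaves
  -- hanging from C:  k|C| + 1 ≤ Σ_C d_H ≤ |X|  and  a|X| ≤ Σ_X deg ≤ Σ_C deg ≤ k·a|C|.
  module Obstruction (a b : ℕ) (1≤a : 1 ≤ a) (b≤ka : b ≤ k * a)
           (deg≥a : ∀ v → a ≤ deg G v) (deg≤b : ∀ v → deg G v ≤ b)
           (C : VSet) (r : Fin N) (r∈C : C r ≡ true) (k<dr : k < d r)
           (saturated : ∀ v → C v ≡ true → Saturated v) (closed : Closed C ∅) where

    Leaf : Fin N → Set
    Leaf x = ∃ λ i → ∃ λ c → m i ≡ true × Adj i c x × C c ≡ true

    Leaf? : ∀ x → Dec (Leaf x)
    Leaf? x = any? λ i → any? λ c → (m i Bool.≟ true) ×-dec (Adj? i c x ×-dec (C c Bool.≟ true))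

    X : VSet
    X x = does (Leaf? x)

    C→X : ∀ t u v → m t ≡ true → Adj t u v → count (C u) ≤ count (X v)
    C→X t u v mt adj with C u in u∈C | Leaf? v
    ... | false | _      = z≤n
    ... | true  | yes _  = ≤-refl
    ... | true  | no ¬lv = ⊥-elim (¬lv (t , u , mt , adj , u∈C))

    X→C : ∀ t u v → full t ≡ true → Adj t u v → count (X u) ≤ count (C v)
    X→C t u v _ adj with Leaf? u
    ... | no _                          = z≤n
    ... | yes (i , c , mi , ai , c∈C) =
      ≤-reflexive (cong count (sym (trans (sym (∨-identityʳ (C v))) (closed c i u t v c∈C mi ai adj))))

    C-degrees : k * size C + 1 ≤ ∑[ v < N ] (count (C v) * d v)
    C-degrees = begin
      k * size C + 1
        ≡⟨ cong₂ _+_ (*-distribˡ-sum k (λ v → count (C v))) (sym (sum-indicator (λ _ → 1) r)) ⟩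
      ∑[ v < N ] (k * count (C v)) + ∑[ v < N ] (indicator r v * 1)
        ≡⟨ ∑-distrib-+ (λ v → k * count (C v)) (λ v → indicator r v * 1) ⟨
      ∑[ v < N ] (k * count (C v) + indicator r v * 1)
        ≤⟨ sum-mono pointwise ⟩
      ∑[ v < N ] (count (C v) * d v) ∎
      where
      open ≤-Reasoning
      pointwise : ∀ v → k * count (C v) + indicator r v * 1 ≤ count (C v) * d v
      pointwise v with r ≟ v
      ... | yes refl rewrite r∈C = begin
        k * 1 + 1   ≡⟨ cong (_+ 1) (*-identityʳ k) ⟩
        k + 1       ≡⟨ +-comm k 1 ⟩
        suc k       ≤⟨ k<dr ⟩
        d v         ≡⟨ *-identityˡ (d v) ⟨
        1 * d v     ∎
      ... | no _ with C v in v∈C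
      ...   | true  = begin
        k * 1 + 0   ≡⟨ trans (+-identityʳ _) (*-identityʳ k) ⟩
        k           ≤⟨ proj₁ (saturated v v∈C) ⟩
        d v         ≡⟨ *-identityˡ (d v) ⟨
        1 * d v     ∎
      ...   | false = ≤-reflexive (trans (+-identityʳ _) (*-zeroʳ k))

    -- Σ_{v ∈ C} d_H(v) ≤ |X|: H-edges from C go to X, whose vertices are leaves.
    C-to-leaves : ∑[ v < N ] (count (C v) * d v) ≤ size X
    C-to-leaves = begin
      ∑[ v < N ] (count (C v) * d v)  ≤⟨ weighted-degree-transfer (λ v → count (C v)) (λ v → count (X v)) m C→X ⟩
      ∑[ v < N ] (count (X v) * d v)  ≤⟨ sum-mono leaf-degree ⟩
      size X                          ∎
      where
      open ≤-Reasoning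
      leaf-degree : ∀ v → count (X v) * d v ≤ count (X v)
      leaf-degree v with Leaf? v
      ... | no _                          = z≤n
      ... | yes (i , c , mi , ai , c∈C) = ≤-trans (≤-reflexive (+-identityʳ _)) (proj₂ (saturated c c∈C) i v mi ai)

    -- a|X| ≤ k·a|C|: G-edges from X go to C.
    leaves-to-C : a * size X ≤ k * a * size C
    leaves-to-C = begin
      a * size X
        ≡⟨ *-distribˡ-sum a (λ v → count (X v)) ⟩
      ∑[ v < N ] (a * count (X v))
        ≤⟨ sum-mono lower ⟩
      ∑[ v < N ] (count (X v) * degree full v)
        ≤⟨ weighted-degree-transfer (λ v → count (X v)) (λ v → count (C v)) full X→C ⟩
      ∑[ v < N ] (count (C v) * degree full v)
        ≤⟨ sum-mono upper ⟩
      ∑[ v < N ] (b * count (C v))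
        ≡⟨ *-distribˡ-sum b (λ v → count (C v)) ⟨
      b * size C
        ≤⟨ *-monoˡ-≤ (size C) b≤ka ⟩
      k * a * size C ∎
      where
      open ≤-Reasoning
      lower : ∀ v → a * count (X v) ≤ count (X v) * degree full v
      lower v = ≤-trans (≤-reflexive (*-comm a _)) (*-monoʳ-≤ (count (X v)) (subst (a ≤_) (deg-full v) (deg≥a v)))
      upper : ∀ v → count (C v) * degree full v ≤ b * count (C v)
      upper v = ≤-trans (*-monoʳ-≤ (count (C v)) (subst (_≤ b) (deg-full v) (deg≤b v))) (≤-reflexive (*-comm _ b))

    no-blocking-set : ⊥
    no-blocking-set = 1+n≰n (begin-strict
      k * a * size C         <⟨ m<m+n _ 1≤a ⟩
      k * a * size C + a     ≡⟨ expand ⟨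
      a * (k * size C + 1)   ≤⟨ *-monoʳ-≤ a (≤-trans C-degrees C-to-leaves) ⟩
      a * size X             ≤⟨ leaves-to-C ⟩
      k * a * size C         ∎)
      where
      open ≤-Reasoning
      distribute : ∀ a k s → a * (k * s + 1) ≡ k * a * s + a
      distribute = solve-∀
      expand : a * (k * size C + 1) ≡ k * a * size C + a
      expand = distribute a k (size C)

-- Each step either finds the goal
-- or moves to a larger state satisfying Inv in which task t is done; done tasks
-- stay done in larger states, so after K steps all of them are done.
module Search {St : Set} (_≼_ : St → St → Set)
  (≼-refl : ∀ {s} → s ≼ s) (≼-trans : ∀ {s₁ s₂ s₃} → s₁ ≼ s₂ → s₂ ≼ s₃ → s₁ ≼ s₃)
  (Inv : St → Set) (Found : Set) where

  Progress : (St → Set) → St → Set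
  Progress P s = Found ⊎ Σ St λ s′ → s ≼ s′ × Inv s′ × P s′

  search : ∀ K (Done : Fin K → St → Set) →
    (∀ t {s s′} → s ≼ s′ → Done t s → Done t s′) →
    (∀ t s → Inv s → Progress (Done t) s) →
    ∀ s → Inv s → Progress (λ s′ → ∀ t → Done t s′) s
  search zero    Done mono step s inv = inj₂ (s , ≼-refl , inv , λ ())
  search (suc K) Done mono step s inv with step zero s inv
  ... | inj₁ found = inj₁ found
  ... | inj₂ (s₁ , s≼s₁ , inv₁ , done₀)
        with search K (λ t → Done (suc t)) (λ t → mono (suc t)) (λ t → step (suc t)) s₁ inv₁
  ...   | inj₁ found = inj₁ found
  ...   | inj₂ (s₂ , s₁≼s₂ , inv₂ , done) =
          inj₂ (s₂ , ≼-trans s≼s₁ s₁≼s₂ , inv₂ , λ { zero → mono zero s₁≼s₂ done₀ ; (suc t) → done t })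

-- Relieving a vertex of the spanning subgraph m (no isolated vertex, k ≥ 2).
-- The search keeps a visited set F ∪ S: F holds vertices found to be blocked,
-- S the vertices on the current path.
module Relief (G : Graph) (k : ℕ) (2≤k : 2 ≤ k) (m : Subgraphs.Mask G)
              (valid : Subgraphs.NoIsolated G m) where
  open Subgraphs G
  open Saturation G k m

  _⊆ˢ_ : VSet → VSet → Set
  A ⊆ˢ B = ∀ v → A v ≡ true → B v ≡ true

  ∪-introˡ : ∀ (A B : VSet) {v} → A v ≡ true → (A ∪ B) v ≡ true
  ∪-introˡ A B v∈A rewrite v∈A = refl

  ∪-introʳ : ∀ (A B : VSet) {v} → B v ≡ true → (A ∪ B) v ≡ true
  ∪-introʳ A B {v} v∈B with A v
  ... | true  = refl
  ... | false = v∈B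

  ∪-elim : ∀ (A B : VSet) {v} → (A ∪ B) v ≡ true → A v ≡ true ⊎ B v ≡ true
  ∪-elim A B {v} v∈A∪B with A v
  ... | true  = inj₁ refl
  ... | false = inj₂ v∈A∪B

  ∉-⊆ : ∀ {A B : VSet} {v} → A ⊆ˢ B → B v ≡ false → A v ≡ false
  ∉-⊆ {A} {B} {v} A⊆B v∉B with A v in v∈A
  ... | false = refl
  ... | true  = trans (sym (A⊆B v v∈A)) v∉B

  ⦅_⦆ : Fin N → VSet
  ⦅ c ⦆ v = does (v ≟ c)

  ⦅⦆-self : ∀ c → ⦅ c ⦆ c ≡ true
  ⦅⦆-self c with c ≟ c
  ... | yes _  = refl
  ... | no c≢c = ⊥-elim (c≢c refl)

  ⦅⦆-sole : ∀ {c v} → ⦅ c ⦆ v ≡ true → v ≡ c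
  ⦅⦆-sole {c} {v} v∈⦅c⦆ with v ≟ c
  ⦅⦆-sole v∈⦅c⦆ | yes v≡c = v≡c
  ⦅⦆-sole ()     | no _

  regroup : ∀ (A B : VSet) c v → ((A ∪ ⦅ c ⦆) ∪ B) v ≡ (A ∪ (B ∪ ⦅ c ⦆)) v
  regroup A B c v = begin
    (A v ∨ ⦅ c ⦆ v) ∨ B v   ≡⟨ ∨-assoc (A v) _ _ ⟩
    A v ∨ (⦅ c ⦆ v ∨ B v)   ≡⟨ cong (A v ∨_) (∨-comm (⦅ c ⦆ v) (B v)) ⟩
    A v ∨ (B v ∨ ⦅ c ⦆ v)   ∎
    where open ≡-Reasoning

  -- The number of unvisited vertices: it strictly drops whenever the visited set
  -- grows, so it bounds the depth of the recursion.
  outside : VSet → ℕ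
  outside A = ∑[ v < N ] count (not (A v))

  outside-< : ∀ {A B c} → A ⊆ˢ B → A c ≡ false → B c ≡ true → outside B < outside A
  outside-< {A} {B} {c} A⊆B c∉A c∈B =
    sum-mono-< shrink c (subst₂ (λ a b → count (not b) < count (not a)) (sym c∉A) (sym c∈B) ≤-refl)
    where
    shrink : ∀ v → count (not (B v)) ≤ count (not (A v))
    shrink v = count-not-mono (A v) (B v) (A⊆B v)
      where
      count-not-mono : ∀ a b → (a ≡ true → b ≡ true) → count (not b) ≤ count (not a)
      count-not-mono false b     _   = count≤1 (not b)
      count-not-mono true  true  _   = z≤n
      count-not-mono true  false a⇒b with a⇒b refl
      ... | ()

  -- A leaf is not saturated (k ≥ 2), so it lies outside any saturated set.
  leaf-outside : ∀ {V : VSet} {x} → (∀ v → V v ≡ true → Saturated v) → d x ≤ 1 → V x ≡ false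
  leaf-outside {V} {x} sat dx≤1 with V x in x∈V
  ... | false = refl
  ... | true  with ≤-trans 2≤k (≤-trans (proj₁ (sat x x∈V)) dx≤1)
  ...   | s≤s ()

  below : ∀ {a b p q} → a ≤ b → b ≤ p ⊎ b ≤ q → a ≤ p ⊎ a ≤ q
  below a≤b (inj₁ b≤p) = inj₁ (≤-trans a≤b b≤p)
  below a≤b (inj₂ b≤q) = inj₂ (≤-trans a≤b b≤q)

  Admissible : VSet → Mask → Set
  Admissible V m′ = NoIsolated m′
                  × (∀ v → degree m′ v ≤ d v ⊎ degree m′ v ≤ k)
                  × (∀ t → m′ t ≢ m t → ∀ v → End t v → V v ≡ false)

  Relieved : Fin N → VSet → Set
  Relieved c V = Σ Mask λ m′ → Admissible V m′ × degree m′ c < d c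

  Blocked : Fin N → VSet → VSet → Set
  Blocked c F S = Σ VSet λ F′ → F ⊆ˢ F′ × F′ c ≡ true
                              × (∀ v → (F′ ∪ S) v ≡ true → Saturated v) × Closed F′ S

  admissible-weaken : ∀ {V V′ m′} → V ⊆ˢ V′ → Admissible V′ m′ → Admissible V m′
  admissible-weaken V⊆V′ (valid′ , bounded , frozen) =
    valid′ , bounded , λ t changed v e → ∉-⊆ V⊆V′ (frozen t changed v e)

  frozen-edge : ∀ {V m′} → Admissible V m′ → ∀ {t v} → V v ≡ true → End t v → m′ t ≡ m t
  frozen-edge {V} {m′} (_ , _ , frozen) {t} v∈V e with m′ t Bool.≟ m t
  ... | yes same    = same
  ... | no changed with trans (sym (frozen t changed _ e)) v∈V
  ...   | ()

  relieve-by-deletion : ∀ (V : VSet) {c i y} → V c ≡ false → k ≤ d c →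
    (∀ v → V v ≡ true → Saturated v) → m i ≡ true → Adj i c y → 2 ≤ d y → Relieved c V
  relieve-by-deletion V {c} {i} {y} c∉V k≤dc sat mi ai 2≤dy =
    delete m i ,
    (Deletion.no-isolated mi ai valid (≤-trans 2≤k k≤dc) 2≤dy , (λ v → inj₁ (delete-≤ mi v)) , frozen) ,
    subst (degree (delete m i) c <_) (trans (+-comm 1 _) (delete-end mi (Adj-endˡ ai))) ≤-refl
    where
    y∉V : V y ≡ false
    y∉V with V y in y∈V
    ... | false = refl
    ... | true with ≤-trans 2≤k (≤-trans k≤dc (proj₂ (sat y y∈V) i c mi (Adj-sym ai)))
    ...   | s≤s ()
    frozen : ∀ t → delete m i t ≢ m t → ∀ v → End t v → V v ≡ false
    frozen t changed v e with update-changed m i false t changed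
    ... | refl with End-Adj ai e
    ...   | inj₁ refl = c∉V
    ...   | inj₂ refl = y∉V

  -- Second way: reroute the leaf x of c to w, working in an admissible m₀ (m itself,
  -- or m after relieving w recursively) that agrees with m at c and in which w has
  -- spare capacity.
  relieve-by-shift : ∀ (V : VSet) (m₀ : Mask) {c x w i j} → Adj i c x → Adj j x w → w ≢ c →
    V c ≡ false → V x ≡ false → V w ≡ false → k ≤ d c →
    Admissible V m₀ → m₀ i ≡ true → degree m₀ c ≡ d c →
    (suc (degree m₀ w) ≤ k ⊎ suc (degree m₀ w) ≤ d w) → Relieved c V
  relieve-by-shift V m₀ {c} {x} {w} {i} {j} ai aj w≢c c∉V x∉V w∉V k≤dc
                   (valid₀ , bounded₀ , frozen₀) m₀i dc₀ room =
    shifted , (no-isolated valid₀ 2≤dc₀ , bounded , frozen) , fewer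
    where
    open Shift m₀ m₀i ai aj w≢c
    2≤dc₀ : 2 ≤ degree m₀ c
    2≤dc₀ = ≤-trans 2≤k (≤-trans k≤dc (≤-reflexive (sym dc₀)))
    fewer : degree shifted c < d c
    fewer = subst (degree shifted c <_) (trans (+-comm 1 _) (trans at-c dc₀)) ≤-refl
    bounded : ∀ v → degree shifted v ≤ d v ⊎ degree shifted v ≤ k
    bounded v with End? j v
    ... | no ¬e = below (off-j ¬e) (bounded₀ v)
    ... | yes e with End-Adj aj e
    ...   | inj₁ refl = below at-x (bounded₀ x)
    ...   | inj₂ refl = below at-w (Data.Sum.swap room)
    frozen : ∀ t → shifted t ≢ m t → ∀ v → End t v → V v ≡ false
    frozen t changed v e with t ≟ j | t ≟ i
    ... | yes refl | _ = [ (λ { refl → x∉V }) , (λ { refl → w∉V }) ]′ (End-Adj aj e)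
    ... | no _ | yes refl = [ (λ { refl → c∉V }) , (λ { refl → x∉V }) ]′ (End-Adj ai e)
    ... | no _ | no _ = frozen₀ t changed v e

  untouched : ∀ V → Admissible V m
  untouched V = valid , (λ v → inj₁ ≤-refl) , (λ t changed → ⊥-elim (changed refl))

  -- If c has an H-neighbour of degree ≥ 2, drop that edge.  Otherwise
  -- c is saturated and `explore` tries every path c – x – w with x a leaf of c: an
  -- unvisited w takes over x directly if d(w) < k, and is relieved recursively
  -- (with c on the path) otherwise.  If every path is blocked, so is c.
  relieve : ∀ fuel c F S → outside (F ∪ S) < fuel → (F ∪ S) c ≡ false → k ≤ d c →
    (∀ v → (F ∪ S) v ≡ true → Saturated v) → Closed F S → Relieved c (F ∪ S) ⊎ Blocked c F S

  explore : ∀ fuel c F S → outside (F ∪ S) ≤ fuel → (F ∪ S) c ≡ false → k ≤ d c →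
    (∀ v → (F ∪ S) v ≡ true → Saturated v) → Closed F S →
    (∀ i y → m i ≡ true → Adj i c y → d y ≤ 1) → Relieved c (F ∪ S) ⊎ Blocked c F S

  relieve zero c F S () _ _ _ _
  relieve (suc fuel) c F S bound c∉ k≤dc sat closed
    with any? (λ i → any? (λ y → (m i Bool.≟ true) ×-dec (Adj? i c y ×-dec (2 ≤? d y))))
  ... | yes (i , y , mi , ai , 2≤dy) = inj₁ (relieve-by-deletion (F ∪ S) c∉ k≤dc sat mi ai 2≤dy)
  ... | no no-heavy-neighbour = explore fuel c F S (≤-pred bound) c∉ k≤dc sat closed
          λ i y mi ai → ≤-pred (≰⇒> λ 2≤dy → no-heavy-neighbour (i , y , mi , ai , 2≤dy))

  explore fuel c F S bound c∉ k≤dc sat closed leaves = conclude (search-all F start)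
    where
    S′ : VSet
    S′ = S ∪ ⦅ c ⦆

    c∈ : ∀ s → (s ∪ S′) c ≡ true
    c∈ s = ∪-introʳ s S′ (∪-introʳ S ⦅ c ⦆ (⦅⦆-self c))

    old⊆ : ∀ {s} → F ⊆ˢ s → (F ∪ S) ⊆ˢ (s ∪ S′)
    old⊆ {s} F⊆s v v∈ with ∪-elim F S v∈
    ... | inj₁ v∈F = ∪-introˡ s S′ (F⊆s v v∈F)
    ... | inj₂ v∈S = ∪-introʳ s S′ (∪-introˡ S ⦅ c ⦆ v∈S)

    Inv : VSet → Set
    Inv s = F ⊆ˢ s × (∀ v → (s ∪ S′) v ≡ true → Saturated v) × Closed s S′

    Done : Fin L → Fin N → Fin L → Fin N → VSet → Set
    Done i x j w s = m i ≡ true → Adj i c x → Adj j x w → (s ∪ S′) w ≡ true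

    Done-mono : ∀ {i x j w s s′} → s ⊆ˢ s′ → Done i x j w s → Done i x j w s′
    Done-mono {w = w} {s} {s′} s⊆s′ done mi ai aj with ∪-elim s S′ (done mi ai aj)
    ... | inj₁ w∈s  = ∪-introˡ s′ S′ (s⊆s′ w w∈s)
    ... | inj₂ w∈S′ = ∪-introʳ s′ S′ w∈S′

    open Search _⊆ˢ_ (λ v v∈ → v∈) (λ A⊆B B⊆C v v∈ → B⊆C v (A⊆B v v∈)) Inv (Relieved c (F ∪ S))

    start : Inv F
    start = (λ v v∈ → v∈) , saturated ,
            λ c₀ i x j w c₀∈F mi ai aj → old⊆ (λ v v∈ → v∈) w (closed c₀ i x j w c₀∈F mi ai aj)
      where
      saturated : ∀ v → (F ∪ S′) v ≡ true → Saturated v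
      saturated v v∈ with ∪-elim F S′ v∈
      ... | inj₁ v∈F = sat v (∪-introˡ F S v∈F)
      ... | inj₂ v∈S′ with ∪-elim S ⦅ c ⦆ v∈S′
      ...   | inj₁ v∈S = sat v (∪-introʳ F S v∈S)
      ...   | inj₂ v∈⦅c⦆ with ⦅⦆-sole {c} {v} v∈⦅c⦆
      ...     | refl = k≤dc , leaves

    shift-via : ∀ {s i x j w} (m₀ : Mask) → F ⊆ˢ s →
      m i ≡ true → Adj i c x → Adj j x w → (s ∪ S′) w ≡ false →
      Admissible (F ∪ S) m₀ → m₀ i ≡ true → degree m₀ c ≡ d c →
      (suc (degree m₀ w) ≤ k ⊎ suc (degree m₀ w) ≤ d w) → Relieved c (F ∪ S)
    shift-via {s} m₀ F⊆s mi ai aj w∉ =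
      relieve-by-shift (F ∪ S) m₀ ai aj w≢c c∉ (leaf-outside sat (leaves _ _ mi ai)) (∉-⊆ (old⊆ F⊆s) w∉) k≤dc
      where
      w≢c : _ ≢ c
      w≢c refl with trans (sym w∉) (c∈ s)
      ... | ()

    explore-edge : ∀ i x j w s → Inv s → Progress (Done i x j w) s
    explore-edge i x j w s inv@(F⊆s , sat-s , closed-s) with m i Bool.≟ true | Adj? i c x | Adj? j x w
    ... | no ¬mi | _      | _      = inj₂ (s , (λ v v∈ → v∈) , inv , λ mi → ⊥-elim (¬mi mi))
    ... | yes _  | no ¬ai | _      = inj₂ (s , (λ v v∈ → v∈) , inv , λ _ ai → ⊥-elim (¬ai ai))
    ... | yes _  | yes _  | no ¬aj = inj₂ (s , (λ v v∈ → v∈) , inv , λ _ _ aj → ⊥-elim (¬aj aj))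
    ... | yes mi | yes ai | yes aj with (s ∪ S′) w in w∈
    ...   | true  = inj₂ (s , (λ v v∈ → v∈) , inv , λ _ _ _ → w∈)
    ...   | false with suc (d w) ≤? k
    ...     | yes room = inj₁ (shift-via m F⊆s mi ai aj w∈ (untouched (F ∪ S)) mi refl (inj₁ room))
    ...     | no ¬room with relieve fuel w s S′ smaller w∈ (≤-pred (≰⇒> ¬room)) sat-s closed-s
      where
      smaller : outside (s ∪ S′) < fuel
      smaller = ≤-trans (outside-< (old⊆ F⊆s) c∉ (c∈ s)) bound
    ...       | inj₂ (F″ , s⊆F″ , w∈F″ , sat″ , closed″) =
                inj₂ (F″ , s⊆F″ , ((λ v v∈ → s⊆F″ v (F⊆s v v∈)) , sat″ , closed″) ,
                      λ _ _ _ → ∪-introˡ F″ S′ w∈F″)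
    ...       | inj₁ (m″ , admissible″ , fewer″) =
                inj₁ (shift-via m″ F⊆s mi ai aj w∈ (admissible-weaken (old⊆ F⊆s) admissible″)
                        (trans (frozen-edge admissible″ (c∈ s) (Adj-endˡ ai)) mi)
                        (degree-ext m m″ c (λ t e → frozen-edge admissible″ (c∈ s) e))
                        (inj₂ fewer″))

    search-all : ∀ s → Inv s → Progress (λ s′ → ∀ i x j w → Done i x j w s′) s
    search-all =
      search L (λ i s → ∀ x j w → Done i x j w s) (λ i s⊆s′ done x j w → Done-mono s⊆s′ (done x j w)) λ i →
      search N (λ x s → ∀ j w → Done i x j w s) (λ x s⊆s′ done j w → Done-mono s⊆s′ (done j w)) λ x →
      search L (λ j s → ∀ w → Done i x j w s) (λ j s⊆s′ done w → Done-mono s⊆s′ (done w)) λ j →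
      search N (λ w → Done i x j w) (λ w → Done-mono) (explore-edge i x j)

    conclude : Progress (λ s → ∀ i x j w → Done i x j w s) F → Relieved c (F ∪ S) ⊎ Blocked c F S
    conclude (inj₁ relieved) = inj₁ relieved
    conclude (inj₂ (s , F⊆s , (_ , sat-s , closed-s) , done)) =
      inj₂ (s ∪ ⦅ c ⦆ , (λ v v∈ → ∪-introˡ s ⦅ c ⦆ (F⊆s v v∈)) , ∪-introʳ s ⦅ c ⦆ (⦅⦆-self c) ,
            saturated , closed′)
      where
      saturated : ∀ v → ((s ∪ ⦅ c ⦆) ∪ S) v ≡ true → Saturated v
      saturated v v∈ = sat-s v (trans (sym (regroup s S c v)) v∈)
      closed′ : Closed (s ∪ ⦅ c ⦆) S
      closed′ c₀ i x j w c₀∈ mi ai aj with ∪-elim s ⦅ c ⦆ c₀∈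
      ... | inj₁ c₀∈s = trans (regroup s S c w) (closed-s c₀ i x j w c₀∈s mi ai aj)
      ... | inj₂ c₀∈⦅c⦆ with ⦅⦆-sole {c} {c₀} c₀∈⦅c⦆
      ...   | refl = trans (regroup s S c w) (done i x j w mi ai aj)

∸-monoˡ-<′ : ∀ {x y} k → x < y → k < y → x ∸ k < y ∸ k
∸-monoˡ-<′ {x} {y} k x<y k<y with ≤-total k x
... | inj₁ k≤x = ∸-monoˡ-< x<y k≤x
... | inj₂ x≤k = subst (_< y ∸ k) (sym (m≤n⇒m∸n≡0 x≤k)) (m<n⇒0<n∸m k<y)

module Balancing (G : Graph) (k : ℕ) (2≤k : 2 ≤ k) (a b : ℕ) (1≤a : 1 ≤ a) (b≤ka : b ≤ k * a)
                 (deg≥a : ∀ v → a ≤ deg G v) (deg≤b : ∀ v → deg G v ≤ b) where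
  open Subgraphs G

  excess : Mask → ℕ
  excess m = ∑[ v < N ] (degree m v ∸ k)

  module _ (m : Mask) (valid : NoIsolated m) where
    open Saturation G k m
    open Relief G k 2≤k m valid

    -- An overloaded vertex can be relieved, which lowers the excess: by the
    -- obstruction, the search from it cannot be blocked.
    improve : ∀ r → k < d r → Σ Mask λ m′ → NoIsolated m′ × excess m′ < excess m
    improve r k<dr with relieve (suc (outside (∅ ∪ ∅))) r ∅ ∅ ≤-refl refl (<⇒≤ k<dr) (λ _ ()) (λ _ _ _ _ _ ())
    ... | inj₁ (m′ , (valid′ , bounded , _) , fewer) =
      m′ , valid′ , sum-mono-< pointwise r (∸-monoˡ-<′ k fewer k<dr)
      where
      pointwise : ∀ v → degree m′ v ∸ k ≤ d v ∸ k
      pointwise v with bounded v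
      ... | inj₁ below-d = ∸-monoˡ-≤ k below-d
      ... | inj₂ below-k = subst (_≤ d v ∸ k) (sym (m≤n⇒m∸n≡0 below-k)) z≤n
    ... | inj₂ (C , _ , r∈C , saturated , closed) =
      ⊥-elim (Obstruction.no-blocking-set a b 1≤a b≤ka deg≥a deg≤b C r r∈C k<dr
                (λ v v∈C → saturated v (∪-introˡ C ∅ v∈C)) closed)

  -- Iterate until no vertex is overloaded; the excess bounds the number of rounds.
  balance : ∀ fuel m → excess m < fuel → NoIsolated m →
    Σ Mask λ m′ → NoIsolated m′ × (∀ v → degree m′ v ≤ k)
  balance zero       _ () _
  balance (suc fuel) m bound valid with any? (λ v → k <? degree m v)
  ... | no none = m , valid , λ v → ≮⇒≥ (λ k<dv → none (v , k<dv))
  ... | yes (r , k<dr) with improve m valid r k<dr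
  ...   | m′ , valid′ , smaller = balance fuel m′ (≤-trans smaller (≤-pred bound)) valid′

  bounded-spanning-subgraph : HasSpanningSub G k
  bounded-spanning-subgraph
    with balance (suc (excess full)) full ≤-refl (λ v → subst (1 ≤_) (deg-full v) (≤-trans 1≤a (deg≥a v)))
  ... | m , valid , bounded =
    select (edges G) m , select-⊆ (edges G) m ,
    λ x → subst (1 ≤_) (sym (degIn-select (edges G) m x)) (valid x) ,
          subst (_≤ k) (sym (degIn-select (edges G) m x)) (bounded x)

deg≤Δ : ∀ G v → deg G v ≤ Δ G
deg≤Δ G v = foldr-preservesᵒ {P = deg G v ≤_} {f = _⊔_}
  (λ x y → [ m≤n⇒m≤n⊔o y , m≤n⇒m≤o⊔n x ]′) 0 _ (inj₂ (map⁺ (lose (∈-allFin v) ≤-refl)))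

minOver≤ : ∀ N (f : Fin N → ℕ) v → minOver N f ≤ f v
minOver≤ (suc N) f v = foldr-preservesᵒ {P = _≤ f v} {f = _⊓_}
  (λ x y → [ m≤n⇒m⊓o≤n y , m≤n⇒o⊓m≤n x ]′) (f zero) _ (inj₂ (map⁺ (lose (∈-allFin v) ≤-refl)))

δ≤deg : ∀ G v → δ G ≤ deg G v
δ≤deg G = minOver≤ (n G) (deg G)

floor-bound : ∀ D d .{{_ : NonZero d}} → D ≤ (1 + D / d) * d
floor-bound D d = begin
  D                  ≡⟨ m≡m%n+[m/n]*n D d ⟩
  D % d + D / d * d  ≤⟨ +-monoˡ-≤ (D / d * d) (<⇒≤ (m%n<n D d)) ⟩
  d + D / d * d      ∎
  where open ≤-Reasoning

floor-≥2 : ∀ D d .{{_ : NonZero d}} → d ≤ D → 2 ≤ 1 + D / d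
floor-≥2 D d d≤D = s≤s (m≥n⇒m/n>0 d≤D)

ceil-bound : ∀ D d .{{_ : NonZero d}} → D ≤ ceilDiv D d * d
ceil-bound D d@(suc e) = +-cancelʳ-≤ e D _ (begin
  D + e                  ≡⟨ cong (_∸ 1) (+-suc D e) ⟨
  M                      ≡⟨ m≡m%n+[m/n]*n M d ⟩
  M % d + M / d * d      ≤⟨ +-monoˡ-≤ (M / d * d) (≤-pred (m%n<n M d)) ⟩
  e + M / d * d          ≡⟨ +-comm e _ ⟩
  M / d * d + e          ∎)
  where
  open ≤-Reasoning
  M = D + d ∸ 1

ceil-≥2 : ∀ D d .{{_ : NonZero d}} → d < D → 2 ≤ ceilDiv D d
ceil-≥2 D d@(suc e) d<D = begin
  2                      ≡⟨ m*n/n≡m 2 d ⟨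
  2 * d / d              ≤⟨ /-monoˡ-≤ d twice-d ⟩
  (D + d ∸ 1) / d        ∎
  where
  open ≤-Reasoning
  double : ∀ e → 2 * suc e ≡ suc (suc e) + e
  double = solve-∀
  twice-d : 2 * d ≤ D + d ∸ 1
  twice-d = begin
    2 * d                ≡⟨ double e ⟩
    suc d + e            ≤⟨ +-monoˡ-≤ e d<D ⟩
    D + e                ≡⟨ cong (_∸ 1) (+-suc D e) ⟨
    D + d ∸ 1            ∎

mainTheorem16 : (G : Graph) → NoIsolatedVertices G → 1 ≤ n G →
    .{{_ : NonZero (δ G)}} → (s : ℕ) → IsSp G s →
    (s ≤ 1 + Δ G / δ G) × (Δ G ≢ δ G → s ≤ ceilDiv (Δ G) (δ G))
mainTheorem16 G _ 1≤n s (_ , s-least) =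
  s-least _ (spanning-with (floor-≥2 (Δ G) (δ G) δ≤Δ) (floor-bound (Δ G) (δ G))) ,
  λ Δ≢δ → s-least _ (spanning-with (ceil-≥2 (Δ G) (δ G) (≤∧≢⇒< δ≤Δ (≢-sym Δ≢δ)))
                                   (ceil-bound (Δ G) (δ G)))
  where
  spanning-with : ∀ {k} → 2 ≤ k → Δ G ≤ k * δ G → HasSpanningSub G k
  spanning-with {k} 2≤k Δ≤kδ =
    Balancing.bounded-spanning-subgraph G k 2≤k (δ G) (Δ G) (>-nonZero⁻¹ (δ G)) Δ≤kδ (δ≤deg G) (deg≤Δ G)
  δ≤Δ : δ G ≤ Δ G
  δ≤Δ = ≤-trans (δ≤deg G (fromℕ< 1≤n)) (deg≤Δ G (fromℕ< 1≤n))
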